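{- For all integers $k,r\ge 2$ there exists a positive integer $q=q_{k,r}$ such that the $r$-uniform hypergraph $\mathcal{H}_q^r$ is $k$-connected.
   Context: Let $[q]=\{1,\dots,q\}$ and $\alpha$ a symbol not in $[q]$. $V(q,r,\alpha)$ is the set of $r$-tuples with exactly one entry equal to $\alpha$ and all others in $[q]$. $\mathcal{H}_q^r$ is the $r$-uniform hypergraph on $V(q,r,\alpha)$ whose edges are indexed by $e\in[q]^r$, the edge $e$ consisting of the $r$ tuples obtained from $e$ by replacing exactly one entry by $\alpha$ (this is a linear hypergraph). In a linear hypergraph, a path from $u$ to $v$ is an alternating sequence $v_0e_1v_1e_2\cdots v_{\ell-1}e_\ell v_\ell$ of vertices and edges with $v_0=u$, $v_\ell=v$, $\{v_{i},v_{i+1}\}\subseteq e_{i+1}$, and any two non-consecutive edges disjoint. Two paths $ue_1v_1\cdots e_\ell v$ and $ue_1'v_1'\cdots e_t'v$ are internally vertex-disjoint if $e_1\cap e_1'=\{u\}$, $e_\ell\cap e_t'=\{v\}$, and all other pairs $e_i,e_j'$ are disjoint; several paths are internally vertex-disjoint if pairwise so. A hypergraph is $k$-connected if for every pair of distinct vertices $u,v$ there are at least $k$ internally vertex-disjoint paths from $u$ to $v$. -}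

module Defs where

open import Data.Nat using (ℕ; zero; suc; _+_; _<_)
open import Data.Fin using (Fin; zero; suc; toℕ; inject₁; fromℕ)
open import Data.Vec using (Vec; map; lookup; _[_]≔_)
open import Data.Maybe using (Maybe; just; nothing)
open import Data.Product using (Σ; _×_; _,_)
open import Data.Empty using (⊥)
open import Relation.Nullary using (¬_)
open import Relation.Binary.PropositionalEquality using (_≡_; _≢_)

-- The symbol α is represented by `nothing`, entries of [q] by `just i`, i : Fin q.
-- A candidate r-tuple over [q] ∪ {α}:
Tuple : ℕ → ℕ → Set
Tuple q r = Vec (Maybe (Fin q)) r

IsVertex : (q r : ℕ) → Tuple q r → Set
IsVertex q r x =
  Σ (Fin r) λ i → (lookup x i ≡ nothing) × (∀ j → lookup x j ≡ nothing → j ≡ i)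

-- Edges of H_q^r are indexed by e ∈ [q]^r.
Edge : ℕ → ℕ → Set
Edge q r = Vec (Fin q) r

_∈E_ : {q r : ℕ} → Tuple q r → Edge q r → Set
_∈E_ {q} {r} x e = Σ (Fin r) λ i → x ≡ (map just e) [ i ]≔ nothing

Disjoint : {q r : ℕ} → Edge q r → Edge q r → Set
Disjoint {q} {r} e f = ∀ (x : Tuple q r) → x ∈E e → x ∈E f → ⊥

MeetExactlyIn : {q r : ℕ} → Edge q r → Edge q r → Tuple q r → Set
MeetExactlyIn {q} {r} e f w =
  ∀ (x : Tuple q r) → ((x ∈E e × x ∈E f) → x ≡ w) × (x ≡ w → x ∈E e × x ∈E f)

-- A path v₀ e₁ v₁ … e_ℓ v_ℓ from u to v of length ℓ = suc m ≥ 1.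
-- Edge e_{i+1} is `edge i` (i : Fin ℓ); vertex v_i is `vert i` (i : Fin (ℓ+1)).
record Path (q r : ℕ) (u v : Tuple q r) : Set where
  field
    m      : ℕ
    vert   : Fin (suc (suc m)) → Tuple q r
    edge   : Fin (suc m) → Edge q r
    start  : vert zero ≡ u
    finish : vert (fromℕ (suc m)) ≡ v
    left   : ∀ i → vert (inject₁ i) ∈E edge i
    right  : ∀ i → vert (suc i) ∈E edge i
    nonconsecutive-disjoint :
      ∀ (i j : Fin (suc m)) → suc (toℕ i) < toℕ j → Disjoint (edge i) (edge j)

open Path public

InternallyDisjoint : {q r : ℕ} {u v : Tuple q r} → Path q r u v → Path q r u v → Set
InternallyDisjoint {q} {r} {u} {v} P Q =
  MeetExactlyIn (edge P zero) (edge Q zero) u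
  × MeetExactlyIn (edge P (fromℕ (m P))) (edge Q (fromℕ (m Q))) v
  × (∀ (i : Fin (suc (m P))) (j : Fin (suc (m Q))) →
       ¬ (i ≡ zero × j ≡ zero) →
       ¬ (i ≡ fromℕ (m P) × j ≡ fromℕ (m Q)) →
       Disjoint (edge P i) (edge Q j))

KConnected : ℕ → ℕ → ℕ → Set
KConnected q r k =
  ∀ (u v : Tuple q r) → IsVertex q r u → IsVertex q r v → u ≢ v →
  Σ (Fin k → Path q r u v) λ P →
    ∀ (a b : Fin k) → a ≢ b → InternallyDisjoint (P a) (P b)

-- Let α sit at position a in u and at position b in v. Each of the k paths is a walk of
-- edges that changes one coordinate per step: coordinate j trades u's entry for a symbol
-- private to the path (at time enter j) and later that symbol for v's entry (at time
-- leave j); at a and b, where u resp. v has α, the entries themselves are private symbols.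
-- Reserving 3k symbols per coordinate away from u's and v's entries (hence q = 9k)
-- makes edges of different paths differ wherever one of them holds a private symbol. The
-- schedule of switches is chosen so that every inner edge holds two private symbols,
-- hence is disjoint from all edges of the other paths, and any two non-consecutive edges
-- of a walk differ in two coordinates. Staggering the switches (coordinate j at times
-- 1 + j and 1 + r + j, up to relabelling the coordinates) works except for r = 2 with
-- a = b, where the α-coordinate jumps directly from one private symbol to the other.

module Submission where

open import Data.Empty using (⊥-elim)
open import Data.Fin using (Fin; zero; suc; toℕ; fromℕ; fromℕ<; opposite; combine; remQuot; _≟_)
open import Data.Fin.Patterns using (0F; 1F; 2F)
open import Data.Fin.Permutation
  using (Permutation′; _⟨$⟩ʳ_; _⟨$⟩ˡ_; inverseˡ; inverseʳ; reverse; transpose)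
open import Data.Fin.Properties
  using ( toℕ-fromℕ; toℕ-inject₁; toℕ-injective; toℕ≤pred[n]; toℕ<n; toℕ-fromℕ<; fromℕ<-injective
        ; opposite-involutive; combine-injective; remQuot-combine; ¬∀⟶∃¬)
open import Data.Maybe using (Maybe; just; nothing; fromMaybe)
open import Data.Maybe.Properties using (just-injective; ≡-dec)
open import Data.Nat using (ℕ; zero; suc; _+_; _*_; _<_; _≤_; _<?_; _≤?_; z≤n; s≤s)
open import Data.Nat.DivMod using (_mod_; _%_; m<n⇒m%n≡m; [m+n]%n≡m%n)
open import Data.Nat.Properties
  using ( <-irrefl; <⇒≱; ≤∧≢⇒<; ≤-refl; ≤-trans; <-trans; <-≤-trans; ≤-pred; <⇒≤; ≰⇒>; ≮⇒≥
        ; n≤1+n; n<1+n; 1+n≢n; suc-injective; n≢0⇒n>0; m≢1+n+m; m≤m+n; m≤n+m; +-comm; +-suc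
        ; +-monoˡ-≤; +-monoʳ-≤; +-monoʳ-<; +-cancelˡ-<; m≤n⇒∃[o]m+o≡n)
import Data.Nat as ℕ
open import Data.Product using (Σ; _×_; _,_; proj₁; proj₂)
open import Data.Sum using (_⊎_; inj₁; inj₂)
open import Data.Vec using (Vec; lookup; tabulate; map; _[_]≔_)
open import Data.Vec.Properties
  using (lookup∘update; lookup∘update′; lookup-map; lookup∘tabulate; tabulate∘lookup; tabulate-cong)
open import Function using (_∘_; case_of_)
open import Relation.Nullary using (¬_; yes; no; contradiction)
open import Relation.Binary.PropositionalEquality
open ≡-Reasoning

open import Defs

lookup-extensionality : ∀ {A : Set} {n} {xs ys : Vec A n} →
  (∀ i → lookup xs i ≡ lookup ys i) → xs ≡ ys
lookup-extensionality {xs = xs} {ys} eq =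
  trans (sym (tabulate∘lookup xs)) (trans (tabulate-cong eq) (tabulate∘lookup ys))

-- Edges and their vertices

module _ {q r : ℕ} where

  vertexAt : Edge q r → Fin r → Tuple q r
  vertexAt e i = map just e [ i ]≔ nothing

  lookup-vertexAt : ∀ (e : Edge q r) i → lookup (vertexAt e i) i ≡ nothing
  lookup-vertexAt e i = lookup∘update i (map just e) nothing

  lookup-vertexAt-≢ : ∀ (e : Edge q r) {i j} → j ≢ i → lookup (vertexAt e i) j ≡ just (lookup e j)
  lookup-vertexAt-≢ e {i} {j} j≢i =
    trans (lookup∘update′ j≢i (map just e) nothing) (lookup-map j just e)

  ≡vertexAt : ∀ {x : Tuple q r} (e : Edge q r) i → lookup x i ≡ nothing →
    (∀ j → j ≢ i → lookup x j ≡ just (lookup e j)) → x ≡ vertexAt e i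
  ≡vertexAt {x} e i xi≡nothing x≡e = lookup-extensionality pointwise
    where
    pointwise : ∀ j → lookup x j ≡ lookup (vertexAt e i) j
    pointwise j with j ≟ i
    ... | yes refl = trans xi≡nothing (sym (lookup-vertexAt e i))
    ... | no j≢i = trans (x≡e j j≢i) (sym (lookup-vertexAt-≢ e j≢i))

  vertexAt-cong : ∀ (e f : Edge q r) i → (∀ j → j ≢ i → lookup e j ≡ lookup f j) →
    vertexAt e i ≡ vertexAt f i
  vertexAt-cong e f i agree = ≡vertexAt f i (lookup-vertexAt e i)
    (λ j j≢i → trans (lookup-vertexAt-≢ e j≢i) (cong just (agree j j≢i)))

  vertexAt-position : ∀ (e f : Edge q r) {i i′} → vertexAt e i ≡ vertexAt f i′ → i ≡ i′
  vertexAt-position e f {i} {i′} eq with i ≟ i′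
  ... | yes i≡i′ = i≡i′
  ... | no i≢i′ with () ← trans (sym (lookup-vertexAt e i))
                             (trans (cong (λ x → lookup x i) eq) (lookup-vertexAt-≢ f i≢i′))

  vertexAt-agree : ∀ (e f : Edge q r) {i j} → vertexAt e i ≡ vertexAt f i → j ≢ i →
    lookup e j ≡ lookup f j
  vertexAt-agree e f {i} {j} eq j≢i = just-injective (begin
    just (lookup e j)      ≡⟨ lookup-vertexAt-≢ e j≢i ⟨
    lookup (vertexAt e i) j ≡⟨ cong (λ x → lookup x j) eq ⟩
    lookup (vertexAt f i) j ≡⟨ lookup-vertexAt-≢ f j≢i ⟩
    just (lookup f j)      ∎)

  common-vertex : ∀ {x : Tuple q r} {e f : Edge q r} → x ∈E e → x ∈E f →
    Σ (Fin r) λ i → x ≡ vertexAt e i × vertexAt e i ≡ vertexAt f i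
  common-vertex {e = e} {f} (i , x≡e) (i′ , x≡f) with vertexAt-position e f (trans (sym x≡e) x≡f)
  ... | refl = i , x≡e , trans (sym x≡e) x≡f

  differ-twice⇒Disjoint : ∀ {e f : Edge q r} {j₁ j₂} → j₁ ≢ j₂ →
    lookup e j₁ ≢ lookup f j₁ → lookup e j₂ ≢ lookup f j₂ → Disjoint e f
  differ-twice⇒Disjoint {e} {f} {j₁} {j₂} j₁≢j₂ d₁ d₂ x x∈e x∈f with common-vertex x∈e x∈f
  ... | i , _ , shared with j₁ ≟ i
  ...   | no j₁≢i = d₁ (vertexAt-agree e f shared j₁≢i)
  ...   | yes refl = d₂ (vertexAt-agree e f shared (j₁≢j₂ ∘ sym))

  Disjoint-sym : ∀ {e f : Edge q r} → Disjoint e f → Disjoint f e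
  Disjoint-sym disjoint x x∈f x∈e = disjoint x x∈e x∈f

  meetExactlyIn-vertexAt : ∀ {e f : Edge q r} {w : Tuple q r} i →
    w ≡ vertexAt e i → w ≡ vertexAt f i → lookup e i ≢ lookup f i → MeetExactlyIn e f w
  meetExactlyIn-vertexAt {e} {f} {w} i w≡e w≡f eᵢ≢fᵢ x =
    only-w , λ { refl → (i , w≡e) , (i , w≡f) }
    where
    only-w : x ∈E e × x ∈E f → x ≡ w
    only-w (x∈e , x∈f) with common-vertex x∈e x∈f
    ... | i′ , x≡e , shared with i′ ≟ i
    ...   | yes refl = trans x≡e (sym w≡e)
    ...   | no i′≢i = ⊥-elim (eᵢ≢fᵢ (vertexAt-agree e f shared (i′≢i ∘ sym)))

-- Paths as walks of edges

record EdgeWalk {q r : ℕ} (u v : Tuple q r) (L : ℕ) : Set where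
  field
    edgeAt      : ℕ → Edge q r
    pivot       : ℕ → Fin r
    u∈first     : u ∈E edgeAt 0
    v∈last      : v ∈E edgeAt L
    consecutive : ∀ n → n < L → ∀ j → j ≢ pivot (suc n) →
                  lookup (edgeAt (suc n)) j ≡ lookup (edgeAt n) j
    separated   : ∀ n m → suc n < m → m ≤ L → Disjoint (edgeAt n) (edgeAt m)

module _ {q r : ℕ} {u v : Tuple q r} {L : ℕ} (W : EdgeWalk u v L) where

  open EdgeWalk W

  walkVertex : ℕ → Tuple q r
  walkVertex zero = u
  walkVertex (suc n) with n ℕ.≟ L
  ... | yes _ = v
  ... | no _ = vertexAt (edgeAt (suc n)) (pivot (suc n))

  walkVertex∈edgeAt : ∀ n → n ≤ L → walkVertex n ∈E edgeAt n
  walkVertex∈edgeAt zero _ = u∈first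
  walkVertex∈edgeAt (suc n) 1+n≤L with n ℕ.≟ L
  ... | yes refl = ⊥-elim (<-irrefl refl 1+n≤L)
  ... | no _ = pivot (suc n) , refl

  walkVertex∈edgeAt-pred : ∀ n → n ≤ L → walkVertex (suc n) ∈E edgeAt n
  walkVertex∈edgeAt-pred n n≤L with n ℕ.≟ L
  ... | yes refl = v∈last
  ... | no n≢L = pivot (suc n) ,
    vertexAt-cong (edgeAt (suc n)) (edgeAt n) (pivot (suc n)) (consecutive n (≤∧≢⇒< n≤L n≢L))

  walkVertex-last : walkVertex (suc L) ≡ v
  walkVertex-last with L ℕ.≟ L
  ... | yes _ = refl
  ... | no L≢L = ⊥-elim (L≢L refl)

  toPath : Path q r u v
  toPath = record
    { m      = L
    ; vert   = walkVertex ∘ toℕ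
    ; edge   = edgeAt ∘ toℕ
    ; start  = refl
    ; finish = trans (cong walkVertex (toℕ-fromℕ (suc L))) walkVertex-last
    ; left   = λ i → subst (λ n → walkVertex n ∈E edgeAt (toℕ i)) (sym (toℕ-inject₁ i))
                           (walkVertex∈edgeAt (toℕ i) (toℕ≤pred[n] i))
    ; right  = λ i → walkVertex∈edgeAt-pred (toℕ i) (toℕ≤pred[n] i)
    ; nonconsecutive-disjoint = λ i j i+1<j → separated (toℕ i) (toℕ j) i+1<j (toℕ≤pred[n] j)
    }

open EdgeWalk using (edgeAt)

toPath-internallyDisjoint : ∀ {q r} {u v : Tuple q r} {L} (W W′ : EdgeWalk u v L) →
  MeetExactlyIn (edgeAt W 0) (edgeAt W′ 0) u →
  MeetExactlyIn (edgeAt W L) (edgeAt W′ L) v →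
  (∀ n m → n ≤ L → m ≤ L → ¬ (n ≡ 0 × m ≡ 0) → ¬ (n ≡ L × m ≡ L) →
    Disjoint (edgeAt W n) (edgeAt W′ m)) →
  InternallyDisjoint (toPath W) (toPath W′)
toPath-internallyDisjoint {L = L} W W′ first last inner =
  first , subst (λ n → MeetExactlyIn (edgeAt W n) (edgeAt W′ n) _) (sym (toℕ-fromℕ L)) last ,
  λ i j not-first not-last → inner (toℕ i) (toℕ j) (toℕ≤pred[n] i) (toℕ≤pred[n] j)
    (λ (i≡0 , j≡0) → not-first (toℕ-injective i≡0 , toℕ-injective j≡0))
    (λ (i≡L , j≡L) → not-last (toℕ-fromℕ-injective i≡L , toℕ-fromℕ-injective j≡L))
  where
  toℕ-fromℕ-injective : ∀ {k : Fin (suc L)} → toℕ k ≡ L → k ≡ fromℕ L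
  toℕ-fromℕ-injective k≡L = toℕ-injective (trans k≡L (sym (toℕ-fromℕ L)))

-- Switching schedules

module _ {r : ℕ} (enter leave : Fin r → ℕ) where

  SwitchesAt : ℕ → Fin r → Set
  SwitchesAt n j = enter j ≡ n ⊎ leave j ≡ n

  SwitchesWithin : ℕ → ℕ → Fin r → Set
  SwitchesWithin n m j = (n < enter j × enter j ≤ m) ⊎ (n < leave j × leave j ≤ m)

  FreshAt : Fin r → Fin r → ℕ → Fin r → Set
  FreshAt a b n j = (enter j ≤ n × n < leave j) ⊎ (n < enter j × j ≡ a) ⊎ (leave j ≤ n × j ≡ b)

-- Coordinate j holds u's entry before time enter j, a private symbol from enter j until
-- leave j, and v's entry from then on; FreshAt n j says that j holds a private symbol at
-- time n, which is also the case for u's α-position a before it switches and for v's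
-- α-position b after.
record Schedule (r : ℕ) (a b : Fin r) : Set where
  field
    length        : ℕ
    enter leave   : Fin r → ℕ
    pivot         : ℕ → Fin r
    0<enter       : ∀ j → 0 < enter j
    enter≤leave   : ∀ j → enter j ≤ leave j
    leave≤length  : ∀ j → leave j ≤ length
    enter≡leave⇒a : ∀ j → enter j ≡ leave j → j ≡ a
    leave≢1+enter : ∀ j → leave j ≢ suc (enter j)
    pivot-switches : ∀ n → 0 < n → n ≤ length → SwitchesAt enter leave n (pivot n)
    switches⇒pivot : ∀ n j → SwitchesAt enter leave n j → pivot n ≡ j
    switches-around : ∀ n m i → n < enter i → enter i < leave i → leave i ≤ m →
      ∀ j → SwitchesWithin enter leave n m j
    two-fresh : ∀ n → 0 < n → n < length →
      Σ (Fin r) λ j₁ → Σ (Fin r) λ j₂ →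
        j₁ ≢ j₂ × FreshAt enter leave a b n j₁ × FreshAt enter leave a b n j₂

relabel : ∀ {r} {a b : Fin r} (π : Permutation′ r) → Schedule r a b →
  Schedule r (π ⟨$⟩ʳ a) (π ⟨$⟩ʳ b)
relabel {r} {a} {b} π S = record
  { length         = length
  ; enter          = enter ∘ π⁻¹
  ; leave          = leave ∘ π⁻¹
  ; pivot          = (π ⟨$⟩ʳ_) ∘ pivot
  ; 0<enter        = 0<enter ∘ π⁻¹
  ; enter≤leave    = enter≤leave ∘ π⁻¹
  ; leave≤length   = leave≤length ∘ π⁻¹
  ; enter≡leave⇒a  = λ j eq → trans (sym (inverseʳ π)) (cong (π ⟨$⟩ʳ_) (enter≡leave⇒a (π⁻¹ j) eq))
  ; leave≢1+enter  = leave≢1+enter ∘ π⁻¹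
  ; pivot-switches = λ n 0<n n≤L →
      subst (SwitchesAt enter leave n) (sym (inverseˡ π)) (pivot-switches n 0<n n≤L)
  ; switches⇒pivot = λ n j sw → trans (cong (π ⟨$⟩ʳ_) (switches⇒pivot n (π⁻¹ j) sw)) (inverseʳ π)
  ; switches-around = λ n m i n<enter enter<leave leave≤m j →
      switches-around n m (π⁻¹ i) n<enter enter<leave leave≤m (π⁻¹ j)
  ; two-fresh      = λ n 0<n n<L → let (j₁ , j₂ , j₁≢j₂ , fresh₁ , fresh₂) = two-fresh n 0<n n<L in
      π ⟨$⟩ʳ j₁ , π ⟨$⟩ʳ j₂ , j₁≢j₂ ∘ π-injective , relabel-fresh fresh₁ , relabel-fresh fresh₂
  }
  where
  open Schedule S
  π⁻¹ : Fin r → Fin r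
  π⁻¹ = π ⟨$⟩ˡ_

  π-injective : ∀ {i j} → π ⟨$⟩ʳ i ≡ π ⟨$⟩ʳ j → i ≡ j
  π-injective eq = trans (sym (inverseˡ π)) (trans (cong π⁻¹ eq) (inverseˡ π))

  relabel-fresh : ∀ {n j} → FreshAt enter leave a b n j →
    FreshAt (enter ∘ π⁻¹) (leave ∘ π⁻¹) (π ⟨$⟩ʳ a) (π ⟨$⟩ʳ b) n (π ⟨$⟩ʳ j)
  relabel-fresh {n} {j} fresh rewrite inverseˡ π {j} with fresh
  ... | inj₁ inside                  = inj₁ inside
  ... | inj₂ (inj₁ (n<enter , refl)) = inj₂ (inj₁ (n<enter , refl))
  ... | inj₂ (inj₂ (leave≤n , refl)) = inj₂ (inj₂ (leave≤n , refl))

-- a ≢ 0 and b ≢ R - 1 supply the second private symbol at the times 1 and 2R - 1.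
module Staggered (t : ℕ) {a b : Fin (suc (suc t))}
  (a≢0 : a ≢ zero) (b≢last : b ≢ fromℕ (suc t)) where

  private
    R : ℕ
    R = suc (suc t)

    enter leave : Fin R → ℕ
    enter j = suc (toℕ j)
    leave j = suc (R + toℕ j)

    pivot : ℕ → Fin R
    pivot n = ℕ.pred n mod R

    pivot-enter : ∀ j → pivot (enter j) ≡ j
    pivot-enter j = toℕ-injective (trans (toℕ-fromℕ< _) (m<n⇒m%n≡m (toℕ<n j)))

    pivot-leave : ∀ j → pivot (leave j) ≡ j
    pivot-leave j = toℕ-injective (begin
      toℕ (pivot (leave j)) ≡⟨ toℕ-fromℕ< _ ⟩
      (R + toℕ j) % R       ≡⟨ cong (_% R) (+-comm R (toℕ j)) ⟩
      (toℕ j + R) % R       ≡⟨ [m+n]%n≡m%n (toℕ j) R ⟩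
      toℕ j % R             ≡⟨ m<n⇒m%n≡m (toℕ<n j) ⟩
      toℕ j                 ∎)

    switches⇒pivot : ∀ n j → SwitchesAt enter leave n j → pivot n ≡ j
    switches⇒pivot _ j (inj₁ refl) = pivot-enter j
    switches⇒pivot _ j (inj₂ refl) = pivot-leave j

    someone-switches : ∀ n → 0 < n → n ≤ R + R → Σ (Fin R) (SwitchesAt enter leave n)
    someone-switches (suc k) _ k<R+R with k <? R
    ... | yes k<R = fromℕ< k<R , inj₁ (cong suc (toℕ-fromℕ< k<R))
    ... | no k≮R with m≤n⇒∃[o]m+o≡n (≮⇒≥ k≮R)
    ...   | x , refl = fromℕ< x<R , inj₂ (cong (λ y → suc (R + y)) (toℕ-fromℕ< x<R))
      where
      x<R : x < R
      x<R = +-cancelˡ-< R x R k<R+R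

    pivot-switches : ∀ n → 0 < n → n ≤ R + R → SwitchesAt enter leave n (pivot n)
    pivot-switches n 0<n n≤R+R with j , switches ← someone-switches n 0<n n≤R+R =
      subst (SwitchesAt enter leave n) (sym (switches⇒pivot n j switches)) switches

    switches-around : ∀ n m i → n < enter i → enter i < leave i → leave i ≤ m →
      ∀ j → SwitchesWithin enter leave n m j
    switches-around n m i n<enterᵢ _ leaveᵢ≤m j with toℕ i ≤? toℕ j
    ... | yes i≤j = inj₁
      ( <-≤-trans n<enterᵢ (s≤s i≤j)
      , ≤-trans (toℕ<n j) (≤-trans (m≤m+n R (toℕ i)) (≤-trans (n≤1+n _) leaveᵢ≤m)))
    ... | no i≰j = inj₂
      ( <-≤-trans n<enterᵢ (≤-trans (toℕ<n i) (≤-trans (m≤m+n R (toℕ j)) (n≤1+n _)))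
      , ≤-trans (s≤s (+-monoʳ-≤ R (<⇒≤ (≰⇒> i≰j)))) leaveᵢ≤m)

    0<a : 0 < toℕ a
    0<a = n≢0⇒n>0 (λ a≡0 → a≢0 (toℕ-injective a≡0))

    b≤t : toℕ b ≤ t
    b≤t = ≤-pred (≤∧≢⇒< (toℕ≤pred[n] b) λ b≡1+t →
      b≢last (toℕ-injective (trans b≡1+t (sym (toℕ-fromℕ (suc t))))))

    t<R : t < R
    t<R = n≤1+n (suc t)

    1+t<R : suc t < R
    1+t<R = n<1+n (suc t)

    during : ∀ {n x} (x<R : x < R) → x < n → n ≤ R + x → FreshAt enter leave a b n (fromℕ< x<R)
    during {n} x<R x<n n≤R+x = inj₁
      ( subst (_< n) (sym (toℕ-fromℕ< x<R)) x<n
      , subst (λ y → n < suc (R + y)) (sym (toℕ-fromℕ< x<R)) (s≤s n≤R+x))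

    fromℕ<-≢ : ∀ {x y} (x<R : x < R) (y<R : y < R) → x ≢ y → fromℕ< x<R ≢ fromℕ< y<R
    fromℕ<-≢ _ _ x≢y eq = x≢y (fromℕ<-injective _ _ _ _ eq)

    two-fresh : ∀ n → 0 < n → n < R + R →
      Σ (Fin R) λ j₁ → Σ (Fin R) λ j₂ →
        j₁ ≢ j₂ × FreshAt enter leave a b n j₁ × FreshAt enter leave a b n j₂
    two-fresh (suc zero) _ _ =
      zero , a , a≢0 ∘ sym , during (s≤s z≤n) (s≤s z≤n) (s≤s z≤n) , inj₂ (inj₁ (s≤s 0<a , refl))
    two-fresh (suc (suc k)) _ n<R+R with suc (suc k) ≤? R
    ... | yes n≤R =
      fromℕ< n≤R , fromℕ< k<R , fromℕ<-≢ n≤R k<R (1+n≢n {k}) ,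
      during n≤R ≤-refl (+-monoˡ-≤ (suc k) {1} {R} (s≤s z≤n)) ,
      during k<R (n≤1+n _) (s≤s (s≤s (m≤n+m k t)))
      where
      k<R : k < R
      k<R = ≤-trans (n≤1+n (suc k)) n≤R
    ... | no n≰R with suc (suc k) ≤? R + t
    ...   | yes n≤R+t =
      fromℕ< 1+t<R , fromℕ< t<R , fromℕ<-≢ 1+t<R t<R (1+n≢n {t}) ,
      during 1+t<R (<-trans (n<1+n _) (≰⇒> n≰R)) (≤-trans n≤R+t (+-monoʳ-≤ R (n≤1+n t))) ,
      during t<R (<-trans (n<1+n t) (<-trans (n<1+n _) (≰⇒> n≰R))) n≤R+t
    ...   | no n≰R+t =
      fromℕ< 1+t<R , b , last≢b ,
      during 1+t<R (<-trans (n<1+n _) (≰⇒> n≰R)) n≤R+1+t ,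
      inj₂ (inj₂ (≤-trans (s≤s (+-monoʳ-≤ R b≤t)) (≰⇒> n≰R+t) , refl))
      where
      n≤R+1+t : suc (suc k) ≤ R + suc t
      n≤R+1+t = ≤-pred (subst (suc (suc (suc k)) ≤_) (+-suc R (suc t)) n<R+R)
      last≢b : fromℕ< 1+t<R ≢ b
      last≢b eq = <-irrefl refl (subst (_≤ t) (trans (sym (cong toℕ eq)) (toℕ-fromℕ< 1+t<R)) b≤t)

  schedule : Schedule R a b
  schedule = record
    { length          = R + R
    ; enter           = enter
    ; leave           = leave
    ; pivot           = pivot
    ; 0<enter         = λ _ → s≤s z≤n
    ; enter≤leave     = λ j → s≤s (m≤n+m (toℕ j) R)
    ; leave≤length    = λ j → +-monoʳ-< R (toℕ<n j)
    ; enter≡leave⇒a   = λ j eq → ⊥-elim (m≢1+n+m (toℕ j) (suc-injective eq))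
    ; leave≢1+enter   = λ j eq → m≢1+n+m (toℕ j) (sym (suc-injective (suc-injective eq)))
    ; pivot-switches  = pivot-switches
    ; switches⇒pivot  = switches⇒pivot
    ; switches-around = switches-around
    ; two-fresh       = two-fresh
    }

-- For r = 2 and a = b no staggered order works; here the α-coordinate switches
-- directly, being private both before and after.
direct₂ : Schedule 2 zero zero
direct₂ = record
  { length          = 3
  ; enter           = enter
  ; leave           = leave
  ; pivot           = pivot
  ; 0<enter         = λ { 0F → s≤s z≤n ; 1F → s≤s z≤n }
  ; enter≤leave     = λ { 0F → ≤-refl ; 1F → s≤s z≤n }
  ; leave≤length    = λ { 0F → n≤1+n 2 ; 1F → ≤-refl }
  ; enter≡leave⇒a   = λ { 0F _ → refl ; 1F () }
  ; leave≢1+enter   = λ { 0F () ; 1F () }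
  ; pivot-switches  = pivot-switches
  ; switches⇒pivot  = switches⇒pivot
  ; switches-around = switches-around
  ; two-fresh       = two-fresh
  }
  where
  enter leave : Fin 2 → ℕ
  enter 0F = 2
  enter 1F = 1
  leave 0F = 2
  leave 1F = 3

  pivot : ℕ → Fin 2
  pivot 2 = 0F
  pivot _ = 1F

  pivot-switches : ∀ n → 0 < n → n ≤ 3 → SwitchesAt enter leave n (pivot n)
  pivot-switches 1 _ _ = inj₁ refl
  pivot-switches 2 _ _ = inj₁ refl
  pivot-switches 3 _ _ = inj₂ refl
  pivot-switches (suc (suc (suc (suc _)))) _ (s≤s (s≤s (s≤s ())))

  switches⇒pivot : ∀ n j → SwitchesAt enter leave n j → pivot n ≡ j
  switches⇒pivot _ 0F (inj₁ refl) = refl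
  switches⇒pivot _ 0F (inj₂ refl) = refl
  switches⇒pivot _ 1F (inj₁ refl) = refl
  switches⇒pivot _ 1F (inj₂ refl) = refl

  switches-around : ∀ n m i → n < enter i → enter i < leave i → leave i ≤ m →
    ∀ j → SwitchesWithin enter leave n m j
  switches-around _ _ 0F _ (s≤s (s≤s ())) _ _
  switches-around (suc _) _ 1F (s≤s ()) _ _ _
  switches-around zero _ 1F _ _ 3≤m 0F = inj₁ (s≤s z≤n , ≤-trans (n≤1+n 2) 3≤m)
  switches-around zero _ 1F _ _ 3≤m 1F = inj₁ (s≤s z≤n , ≤-trans (s≤s z≤n) 3≤m)

  two-fresh : ∀ n → 0 < n → n < 3 →
    Σ (Fin 2) λ j₁ → Σ (Fin 2) λ j₂ →
      j₁ ≢ j₂ × FreshAt enter leave zero zero n j₁ × FreshAt enter leave zero zero n j₂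
  two-fresh 1 _ _ = 1F , 0F , (λ ()) , inj₁ (≤-refl , s≤s (s≤s z≤n)) , inj₂ (inj₁ (≤-refl , refl))
  two-fresh 2 _ _ = 1F , 0F , (λ ()) , inj₁ (s≤s z≤n , ≤-refl) , inj₂ (inj₂ (≤-refl , refl))
  two-fresh (suc (suc (suc _))) _ (s≤s (s≤s (s≤s ())))

reversed : ∀ {t} {a b : Fin (suc (suc t))} → a ≢ fromℕ (suc t) → b ≢ zero →
  Schedule (suc (suc t)) a b
reversed {t} {a} {b} a≢last b≢0 =
  subst₂ (Schedule _) (opposite-involutive a) (opposite-involutive b)
    (relabel reverse (Staggered.schedule t opposite-a≢0 opposite-b≢last))
  where
  opposite-a≢0 : opposite a ≢ zero
  opposite-a≢0 eq = a≢last (trans (sym (opposite-involutive a)) (cong opposite eq))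
  opposite-b≢last : opposite b ≢ fromℕ (suc t)
  opposite-b≢last eq =
    b≢0 (trans (sym (opposite-involutive b)) (trans (cong opposite eq) (opposite-involutive zero)))

schedule : ∀ {t} (a b : Fin (suc (suc t))) → Schedule (suc (suc t)) a b
schedule {t} a b with a ≟ b
... | no a≢b with a ≟ zero | b ≟ fromℕ (suc t)
...   | no a≢0   | no b≢last = Staggered.schedule t a≢0 b≢last
...   | yes refl | _         = reversed (λ ()) (a≢b ∘ sym)
...   | no _     | yes refl  = reversed a≢b (λ ())
schedule {zero} 0F .0F | yes refl = direct₂
schedule {zero} 1F .1F | yes refl = relabel reverse direct₂
schedule {suc t} a .a  | yes refl =
  relabel (transpose 1F a) (Staggered.schedule (suc t) {1F} {1F} (λ ()) (λ ()))

-- Private symbols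

data Phase : Set where
  before during after : Phase

record SymbolSupply (q r K : ℕ) (u v : Tuple q r) : Set where
  field
    symbol           : Fin r → Phase → Fin K → Fin q
    symbol-injective : ∀ {j ρ σ p p′} → symbol j ρ p ≡ symbol j σ p′ → ρ ≡ σ × p ≡ p′
    symbol∉u         : ∀ {j ρ p x} → lookup u j ≡ just x → symbol j ρ p ≢ x
    symbol∉v         : ∀ {j ρ p x} → lookup v j ≡ just x → symbol j ρ p ≢ x

phaseIndex : Phase → Fin 3
phaseIndex before = 0F
phaseIndex during = 1F
phaseIndex after  = 2F

phaseIndex-injective : ∀ {ρ σ} → phaseIndex ρ ≡ phaseIndex σ → ρ ≡ σ
phaseIndex-injective {before} {before} _ = refl
phaseIndex-injective {during} {during} _ = refl
phaseIndex-injective {after}  {after}  _ = refl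
phaseIndex-injective {before} {during} ()
phaseIndex-injective {before} {after}  ()
phaseIndex-injective {during} {before} ()
phaseIndex-injective {during} {after}  ()
phaseIndex-injective {after}  {before} ()
phaseIndex-injective {after}  {during} ()

third : Fin 3 → Fin 3 → Fin 3
third 0F 0F = 1F
third 0F 1F = 2F
third 0F 2F = 1F
third 1F 0F = 2F
third 1F 1F = 0F
third 1F 2F = 0F
third 2F 0F = 1F
third 2F 1F = 0F
third 2F 2F = 0F

third-fresh : ∀ i j → third i j ≢ i × third i j ≢ j
third-fresh 0F 0F = (λ ()) , (λ ())
third-fresh 0F 1F = (λ ()) , (λ ())
third-fresh 0F 2F = (λ ()) , (λ ())
third-fresh 1F 0F = (λ ()) , (λ ())
third-fresh 1F 1F = (λ ()) , (λ ())
third-fresh 1F 2F = (λ ()) , (λ ())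
third-fresh 2F 0F = (λ ()) , (λ ())
third-fresh 2F 1F = (λ ()) , (λ ())
third-fresh 2F 2F = (λ ()) , (λ ())

-- [q] splits into three blocks of 3 * K symbols; coordinate j draws its private symbols
-- from a block containing neither u's nor v's entry at j.
symbolSupply : ∀ {r} K (u v : Tuple (3 * (3 * K)) r) → SymbolSupply (3 * (3 * K)) r K u v
symbolSupply {r} K u v = record
  { symbol           = symbol
  ; symbol-injective = λ {j ρ σ p p′} eq →
      let (ρσ , pp′) = combine-injective (phaseIndex ρ) p (phaseIndex σ) p′
                         (proj₂ (combine-injective (freshBlock j) _ (freshBlock j) _ eq))
      in phaseIndex-injective ρσ , pp′
  ; symbol∉u         = λ {j ρ p} u-j eq →
      proj₁ (third-fresh _ _) (symbol-block {j} {ρ} {p} eq (cong block (sym u-j)))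
  ; symbol∉v         = λ {j ρ p} v-j eq →
      proj₂ (third-fresh _ _) (symbol-block {j} {ρ} {p} eq (cong block (sym v-j)))
  }
  where
  block : Maybe (Fin (3 * (3 * K))) → Fin 3
  block nothing  = 0F
  block (just x) = proj₁ (remQuot (3 * K) x)

  freshBlock : Fin r → Fin 3
  freshBlock j = third (block (lookup u j)) (block (lookup v j))

  symbol : Fin r → Phase → Fin K → Fin (3 * (3 * K))
  symbol j ρ p = combine (freshBlock j) (combine (phaseIndex ρ) p)

  symbol-block : ∀ {j ρ p x} {i : Fin 3} → symbol j ρ p ≡ x → block (just x) ≡ i → freshBlock j ≡ i
  symbol-block {j} {ρ} {p} refl block≡i =
    trans (sym (cong proj₁ (remQuot-combine (freshBlock j) (combine (phaseIndex ρ) p)))) block≡i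

-- The k walks

module Construction {q r K : ℕ} {u v : Tuple q r} {a b : Fin r}
  (u-α : lookup u a ≡ nothing) (u-α! : ∀ j → lookup u j ≡ nothing → j ≡ a)
  (v-α : lookup v b ≡ nothing) (v-α! : ∀ j → lookup v j ≡ nothing → j ≡ b)
  (u≢v : u ≢ v) (supply : SymbolSupply q r K u v) (S : Schedule r a b) where

  open SymbolSupply supply
  open Schedule S

  phase : ℕ → Fin r → Phase
  phase n j with n <? enter j | n <? leave j
  ... | yes _ | _     = before
  ... | no _  | yes _ = during
  ... | no _  | no _  = after

  phase-before : ∀ {n j} → n < enter j → phase n j ≡ before
  phase-before {n} {j} n<enter with n <? enter j
  ... | yes _ = refl
  ... | no n≮enter = contradiction n<enter n≮enter

  phase-during : ∀ {n j} → enter j ≤ n → n < leave j → phase n j ≡ during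
  phase-during {n} {j} enter≤n n<leave with n <? enter j | n <? leave j
  ... | yes n<enter | _            = contradiction enter≤n (<⇒≱ n<enter)
  ... | no _        | yes _        = refl
  ... | no _        | no n≮leave   = contradiction n<leave n≮leave

  phase-after : ∀ {n j} → leave j ≤ n → phase n j ≡ after
  phase-after {n} {j} leave≤n with n <? enter j | n <? leave j
  ... | yes n<enter | _          = contradiction (≤-trans (enter≤leave j) leave≤n) (<⇒≱ n<enter)
  ... | no _        | yes n<leave = contradiction leave≤n (<⇒≱ n<leave)
  ... | no _        | no _        = refl

  phase-step : ∀ n j → ¬ SwitchesAt enter leave (suc n) j → phase (suc n) j ≡ phase n j
  phase-step n j no-switch with n <? enter j | n <? leave j
  ... | yes n<enter | _ =
    phase-before (≤∧≢⇒< n<enter (no-switch ∘ inj₁ ∘ sym))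
  ... | no n≮enter | yes n<leave =
    phase-during (≤-trans (≮⇒≥ n≮enter) (n≤1+n n)) (≤∧≢⇒< n<leave (no-switch ∘ inj₂ ∘ sym))
  ... | no _ | no n≮leave = phase-after (≤-trans (≮⇒≥ n≮leave) (n≤1+n n))

  entry : Fin K → Fin r → Phase → Fin q
  entry p j before = fromMaybe (symbol j before p) (lookup u j)
  entry p j during = symbol j during p
  entry p j after  = fromMaybe (symbol j after p) (lookup v j)

  symbol≢entry : ∀ {j ρ σ p p′} → ¬ (ρ ≡ σ × p ≡ p′) → symbol j ρ p ≢ entry p′ j σ
  symbol≢entry {σ = during} distinct = distinct ∘ symbol-injective
  symbol≢entry {j} {σ = before} distinct with lookup u j in u-j
  ... | nothing = distinct ∘ symbol-injective
  ... | just _  = symbol∉u u-j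
  symbol≢entry {j} {σ = after} distinct with lookup v j in v-j
  ... | nothing = distinct ∘ symbol-injective
  ... | just _  = symbol∉v v-j

  before≢during : ∀ {j p} → entry p j before ≢ entry p j during
  before≢during eq = symbol≢entry {σ = before} (λ { (() , _) }) (sym eq)

  during≢after : ∀ {j p} → entry p j during ≢ entry p j after
  during≢after = symbol≢entry {σ = after} (λ { (() , _) })

  Separated : Fin r → Set
  Separated j = ∀ x → lookup u j ≡ just x → lookup v j ≢ just x

  before≢after : ∀ {j p p′} → Separated j → entry p j before ≢ entry p′ j after
  before≢after {j} sep with lookup u j in u-j
  ... | nothing = symbol≢entry {σ = after} (λ { (() , _) })
  ... | just x with lookup v j in v-j
  ...   | nothing = λ x≡symbol → symbol∉u u-j (sym x≡symbol)
  ...   | just _  = λ x≡y → sep x refl (cong just (sym x≡y))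

  walkEdge : Fin K → ℕ → Edge q r
  walkEdge p n = tabulate (λ j → entry p j (phase n j))

  lookup-walkEdge : ∀ p n j → lookup (walkEdge p n) j ≡ entry p j (phase n j)
  lookup-walkEdge p n j = lookup∘tabulate (λ j → entry p j (phase n j)) j

  same-lookup⇒same-entry : ∀ {p p′ n m j} → lookup (walkEdge p n) j ≡ lookup (walkEdge p′ m) j →
    entry p j (phase n j) ≡ entry p′ j (phase m j)
  same-lookup⇒same-entry {p} {p′} {n} {m} {j} eq =
    trans (sym (lookup-walkEdge p n j)) (trans eq (lookup-walkEdge p′ m j))

  entries-differ : ∀ {p p′ n m j} → entry p j (phase n j) ≢ entry p′ j (phase m j) →
    lookup (walkEdge p n) j ≢ lookup (walkEdge p′ m) j
  entries-differ differ = differ ∘ same-lookup⇒same-entry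

  u-outside-α : ∀ {j p} → j ≢ a → lookup u j ≡ just (entry p j before)
  u-outside-α {j} j≢a with lookup u j in u-j
  ... | nothing = ⊥-elim (j≢a (u-α! j u-j))
  ... | just _  = refl

  v-outside-α : ∀ {j p} → j ≢ b → lookup v j ≡ just (entry p j after)
  v-outside-α {j} j≢b with lookup v j in v-j
  ... | nothing = ⊥-elim (j≢b (v-α! j v-j))
  ... | just _  = refl

  u-first : ∀ p → u ≡ vertexAt (walkEdge p 0) a
  u-first p = ≡vertexAt (walkEdge p 0) a u-α λ j j≢a → begin
    lookup u j                           ≡⟨ u-outside-α j≢a ⟩
    just (entry p j before)              ≡⟨ cong (just ∘ entry p j) (phase-before (0<enter j)) ⟨
    just (entry p j (phase 0 j))         ≡⟨ cong just (lookup-walkEdge p 0 j) ⟨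
    just (lookup (walkEdge p 0) j)       ∎

  v-last : ∀ p → v ≡ vertexAt (walkEdge p length) b
  v-last p = ≡vertexAt (walkEdge p length) b v-α λ j j≢b → begin
    lookup v j                           ≡⟨ v-outside-α j≢b ⟩
    just (entry p j after)               ≡⟨ cong (just ∘ entry p j) (phase-after (leave≤length j)) ⟨
    just (entry p j (phase length j))    ≡⟨ cong just (lookup-walkEdge p length j) ⟨
    just (lookup (walkEdge p length) j)  ∎

  fresh-entry : ∀ {n j} p → FreshAt enter leave a b n j →
    Σ Phase λ ρ → entry p j (phase n j) ≡ symbol j ρ p
  fresh-entry p (inj₁ (enter≤n , n<leave)) =
    during , cong (entry p _) (phase-during enter≤n n<leave)
  fresh-entry p (inj₂ (inj₁ (n<enter , refl))) =
    before , trans (cong (entry p a) (phase-before n<enter)) (cong (fromMaybe _) u-α)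
  fresh-entry p (inj₂ (inj₂ (leave≤n , refl))) =
    after , trans (cong (entry p b) (phase-after leave≤n)) (cong (fromMaybe _) v-α)

  fresh-differs : ∀ {p p′ n m j} → p ≢ p′ → FreshAt enter leave a b n j →
    lookup (walkEdge p n) j ≢ lookup (walkEdge p′ m) j
  fresh-differs {p} {p′} {n} {m} {j} p≢p′ fresh with _ , entry≡symbol ← fresh-entry p fresh =
    entries-differ λ eq → symbol≢entry {σ = phase m j} (p≢p′ ∘ proj₂) (trans (sym entry≡symbol) eq)

  separated-a : Separated a
  separated-a _ u-a with () ← trans (sym u-α) u-a

  two-separated : Σ (Fin r) λ w₁ → Σ (Fin r) λ w₂ → w₁ ≢ w₂ × Separated w₁ × Separated w₂
  two-separated with a ≟ b
  ... | no a≢b = a , b , a≢b , separated-a , λ { _ _ v-b → case trans (sym v-α) v-b of λ () }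
  ... | yes refl
    with j , uⱼ≢vⱼ ← ¬∀⟶∃¬ r _ (λ j → ≡-dec _≟_ (lookup u j) (lookup v j))
                                (u≢v ∘ lookup-extensionality) =
    a , j , (λ { refl → uⱼ≢vⱼ (trans u-α (sym v-α)) }) , separated-a ,
    λ _ u-j v-j → uⱼ≢vⱼ (trans u-j (sym v-j))

  switching-phases : ∀ {n m j} → SwitchesWithin enter leave n m j →
    (phase n j ≡ before × phase m j ≡ during) ⊎ (phase n j ≡ during × phase m j ≡ after) ⊎
    (n < enter j × leave j ≤ m)
  switching-phases {n} {m} {j} (inj₁ (n<enter , enter≤m)) with leave j ≤? m
  ... | yes leave≤m = inj₂ (inj₂ (n<enter , leave≤m))
  ... | no leave≰m  = inj₁ (phase-before n<enter , phase-during enter≤m (≰⇒> leave≰m))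
  switching-phases {n} {m} {j} (inj₂ (n<leave , leave≤m)) with enter j ≤? n
  ... | yes enter≤n = inj₂ (inj₁ (phase-during enter≤n n<leave , phase-after leave≤m))
  ... | no enter≰n  = inj₂ (inj₂ (≰⇒> enter≰n , leave≤m))

  separated-switch-differs : ∀ {p n m j} → SwitchesWithin enter leave n m j → Separated j →
    entry p j (phase n j) ≢ entry p j (phase m j)
  separated-switch-differs {n = n} {m} {j} switch sep with switching-phases switch
  ... | inj₁ (at-n , at-m) rewrite at-n | at-m = before≢during
  ... | inj₂ (inj₁ (at-n , at-m)) rewrite at-n | at-m = during≢after
  ... | inj₂ (inj₂ (n<enter , leave≤m))
    rewrite phase-before {n} {j} n<enter | phase-after {m} {j} leave≤m = before≢after sep

  unchanged-switch⇒crossing : ∀ {p n m j} → SwitchesWithin enter leave n m j →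
    entry p j (phase n j) ≡ entry p j (phase m j) → n < enter j × leave j ≤ m
  unchanged-switch⇒crossing switch unchanged with switching-phases switch
  ... | inj₁ (at-n , at-m) rewrite at-n | at-m = ⊥-elim (before≢during unchanged)
  ... | inj₂ (inj₁ (at-n , at-m)) rewrite at-n | at-m = ⊥-elim (during≢after unchanged)
  ... | inj₂ (inj₂ crossing) = crossing

  all-switch⇒Disjoint : ∀ {p n m} → (∀ j → SwitchesWithin enter leave n m j) →
    Disjoint (walkEdge p n) (walkEdge p m)
  all-switch⇒Disjoint all-switch with w₁ , w₂ , w₁≢w₂ , sep₁ , sep₂ ← two-separated =
    differ-twice⇒Disjoint w₁≢w₂
      (entries-differ (separated-switch-differs (all-switch w₁) sep₁))
      (entries-differ (separated-switch-differs (all-switch w₂) sep₂))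

  -- A coordinate that switches but ends where it started crossed its whole private
  -- window, which forces every coordinate to switch.
  unchanged-switch⇒Disjoint : ∀ {p n m j} → SwitchesWithin enter leave n m j →
    lookup (walkEdge p n) j ≡ lookup (walkEdge p m) j → Disjoint (walkEdge p n) (walkEdge p m)
  unchanged-switch⇒Disjoint {p} {n} {m} {j} switch unchanged
    with n<enter , leave≤m ← unchanged-switch⇒crossing switch (same-lookup⇒same-entry unchanged)
    with enter j ℕ.≟ leave j
  ... | yes enter≡leave = ⊥-elim (separated-switch-differs switch
          (subst Separated (sym (enter≡leave⇒a j enter≡leave)) separated-a)
          (same-lookup⇒same-entry unchanged))
  ... | no enter≢leave =
    all-switch⇒Disjoint (switches-around n m j n<enter (≤∧≢⇒< (enter≤leave j) enter≢leave) leave≤m)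

  no-consecutive-switches : ∀ n j → SwitchesAt enter leave (suc n) j →
    ¬ SwitchesAt enter leave (suc (suc n)) j
  no-consecutive-switches n j (inj₁ e₁) (inj₁ e₂) = 1+n≢n (trans (sym e₂) e₁)
  no-consecutive-switches n j (inj₂ l₁) (inj₂ l₂) = 1+n≢n (trans (sym l₂) l₁)
  no-consecutive-switches n j (inj₁ e₁) (inj₂ l₂) = leave≢1+enter j (trans l₂ (cong suc (sym e₁)))
  no-consecutive-switches n j (inj₂ l₁) (inj₁ e₂) = <-irrefl refl (subst₂ _≤_ e₂ l₁ (enter≤leave j))

  pivot-switches-within : ∀ {n m k} → n < k → k ≤ m → m ≤ length →
    SwitchesWithin enter leave n m (pivot k)
  pivot-switches-within {n} {m} {k} n<k k≤m m≤L
    with pivot-switches k (≤-trans (s≤s z≤n) n<k) (≤-trans k≤m m≤L)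
  ... | inj₁ enter≡k = inj₁ (subst (n <_) (sym enter≡k) n<k , subst (_≤ m) (sym enter≡k) k≤m)
  ... | inj₂ leave≡k = inj₂ (subst (n <_) (sym leave≡k) n<k , subst (_≤ m) (sym leave≡k) k≤m)

  -- The coordinates switching at times n + 1 and n + 2 are distinct and both switch
  -- between n and m; each of them separates the two edges unless it is unchanged.
  separated-edges : ∀ p n m → suc n < m → m ≤ length → Disjoint (walkEdge p n) (walkEdge p m)
  separated-edges p n m 1+n<m m≤L
    with lookup (walkEdge p n) (pivot (suc n)) ≟ lookup (walkEdge p m) (pivot (suc n))
       | lookup (walkEdge p n) (pivot (suc (suc n))) ≟ lookup (walkEdge p m) (pivot (suc (suc n)))
  ... | yes unchanged | _ =
    unchanged-switch⇒Disjoint (pivot-switches-within ≤-refl (<⇒≤ 1+n<m) m≤L) unchanged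
  ... | no _ | yes unchanged =
    unchanged-switch⇒Disjoint (pivot-switches-within (n≤1+n _) 1+n<m m≤L) unchanged
  ... | no changed₁ | no changed₂ = differ-twice⇒Disjoint pivots-distinct changed₁ changed₂
    where
    2+n≤L : suc (suc n) ≤ length
    2+n≤L = ≤-trans 1+n<m m≤L
    pivots-distinct : pivot (suc n) ≢ pivot (suc (suc n))
    pivots-distinct eq = no-consecutive-switches n (pivot (suc n))
      (pivot-switches (suc n) (s≤s z≤n) (≤-trans (n≤1+n _) 2+n≤L))
      (subst (SwitchesAt enter leave (suc (suc n))) (sym eq)
        (pivot-switches (suc (suc n)) (s≤s z≤n) 2+n≤L))

  walk : Fin K → EdgeWalk u v length
  walk p = record
    { edgeAt      = walkEdge p
    ; pivot       = pivot
    ; u∈first     = a , u-first p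
    ; v∈last      = b , v-last p
    ; consecutive = λ n _ j j≢pivot →
        trans (lookup-walkEdge p (suc n) j)
          (trans (cong (entry p j) (phase-step n j (j≢pivot ∘ sym ∘ switches⇒pivot (suc n) j)))
                 (sym (lookup-walkEdge p n j)))
    ; separated   = separated-edges p
    }

  time-position : ∀ {n} → n ≤ length → n ≡ 0 ⊎ n ≡ length ⊎ (0 < n × n < length)
  time-position {zero} _ = inj₁ refl
  time-position {suc n} n≤L with suc n ℕ.≟ length
  ... | yes n≡L = inj₂ (inj₁ n≡L)
  ... | no n≢L  = inj₂ (inj₂ (s≤s z≤n , ≤∧≢⇒< n≤L n≢L))

  fresh⇒Disjoint : ∀ {p p′ n m} → p ≢ p′ → 0 < n → n < length →
    Disjoint (walkEdge p n) (walkEdge p′ m)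
  fresh⇒Disjoint {n = n} p≢p′ 0<n n<L with j₁ , j₂ , j₁≢j₂ , fresh₁ , fresh₂ ← two-fresh n 0<n n<L =
    differ-twice⇒Disjoint j₁≢j₂ (fresh-differs p≢p′ fresh₁) (fresh-differs p≢p′ fresh₂)

  first-last-Disjoint : ∀ p p′ → Disjoint (walkEdge p 0) (walkEdge p′ length)
  first-last-Disjoint p p′ with w₁ , w₂ , w₁≢w₂ , sep₁ , sep₂ ← two-separated =
    differ-twice⇒Disjoint w₁≢w₂ (differs sep₁) (differs sep₂)
    where
    differs : ∀ {w} → Separated w → lookup (walkEdge p 0) w ≢ lookup (walkEdge p′ length) w
    differs {w} sep = entries-differ λ eq → before≢after sep
      (trans (cong (entry p w) (sym (phase-before (0<enter w))))
             (trans eq (cong (entry p′ w) (phase-after (leave≤length w)))))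

  inner-Disjoint : ∀ {p p′} → p ≢ p′ → ∀ n m → n ≤ length → m ≤ length →
    ¬ (n ≡ 0 × m ≡ 0) → ¬ (n ≡ length × m ≡ length) → Disjoint (walkEdge p n) (walkEdge p′ m)
  inner-Disjoint {p} {p′} p≢p′ n m n≤L m≤L not-first not-last
    with time-position n≤L | time-position m≤L
  ... | inj₂ (inj₂ (0<n , n<L)) | _ = fresh⇒Disjoint p≢p′ 0<n n<L
  ... | _ | inj₂ (inj₂ (0<m , m<L)) = Disjoint-sym (fresh⇒Disjoint (p≢p′ ∘ sym) 0<m m<L)
  ... | inj₁ refl        | inj₁ refl        = ⊥-elim (not-first (refl , refl))
  ... | inj₂ (inj₁ refl) | inj₂ (inj₁ refl) = ⊥-elim (not-last (refl , refl))
  ... | inj₁ refl        | inj₂ (inj₁ refl) = first-last-Disjoint p p′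
  ... | inj₂ (inj₁ refl) | inj₁ refl        = Disjoint-sym (first-last-Disjoint p′ p)

  paths : Σ (Fin K → Path q r u v) λ P → ∀ p p′ → p ≢ p′ → InternallyDisjoint (P p) (P p′)
  paths = toPath ∘ walk , λ p p′ p≢p′ → toPath-internallyDisjoint (walk p) (walk p′)
    (meetExactlyIn-vertexAt a (u-first p) (u-first p′)
      (fresh-differs p≢p′ (inj₂ (inj₁ (0<enter a , refl)))))
    (meetExactlyIn-vertexAt b (v-last p) (v-last p′)
      (fresh-differs p≢p′ (inj₂ (inj₂ (leave≤length b , refl)))))
    (inner-Disjoint p≢p′)

proposition5 : ∀ (k r : ℕ) → 2 ≤ k → 2 ≤ r →
    Σ ℕ λ q → (1 ≤ q) × KConnected q r k
proposition5 k (suc (suc t)) (s≤s (s≤s z≤n)) (s≤s (s≤s z≤n)) = 3 * (3 * k) , s≤s z≤n , connected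
  where
  connected : KConnected (3 * (3 * k)) (suc (suc t)) k
  connected u v (a , u-α , u-α!) (b , v-α , v-α!) u≢v =
    Construction.paths u-α u-α! v-α v-α! u≢v (symbolSupply k u v) (schedule a b)
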